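{- Let $y=r\mathrm{i}$ where $r$ is an algebraic real number with $r\notin\{0,1,-1\}$. Then there exists an algebraic real number $y'\in(-1,0)$ that can be obtained from $y$ by a finite sequence of stretchings and thickenings.
   Context: For a positive integer $k$, the $k$-thickening maps an (Ising) edge interaction $w$ to $w^k$ (replacing an edge by $k$ parallel edges), and the $k$-stretch maps $w\neq1$ to $1+\frac{2}{\left(\frac{w+1}{w-1}\right)^k-1}$ (replacing an edge by a path of $k$ edges), defined when the denominator is nonzero. "Obtained by a finite sequence of stretchings and thickenings" means obtained from $y$ by finitely many successive applications of these maps (each applied where defined). -}

module Defs where

open import Level using (Level; _⊔_) renaming (suc to lsuc)
open import Algebra.Bundles using (CommutativeRing)
open import Data.Nat using (ℕ; zero; suc) renaming (_*_ to _*ℕ_)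
open import Data.Integer using (ℤ; +_; -[1+_])
open import Data.List using (List; []; _∷_; length; _++_; [_]; any)
open import Data.List.Relation.Unary.Any using (Any)
open import Data.Product using (Σ; ∃; _×_; _,_)
open import Data.Sum using (_⊎_)
open import Relation.Binary using (Rel)
open import Relation.Nullary using (¬_)
open import Relation.Binary.PropositionalEquality using (_≡_)

-- Polynomials as coefficient lists (lowest degree first), Horner evaluation.

module Poly {c ℓ} (R : CommutativeRing c ℓ) where
  open CommutativeRing R

  eval : List Carrier → Carrier → Carrier
  eval []       x = 0#
  eval (a ∷ cs) x = a + x * eval cs x

  fromℕ : ℕ → Carrier
  fromℕ zero    = 0#
  fromℕ (suc n) = 1# + fromℕ n

  fromℤ : ℤ → Carrier
  fromℤ (+ n)    = fromℕ n
  fromℤ -[1+ n ] = - fromℕ (suc n)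

  mapℤ : List ℤ → List Carrier
  mapℤ []       = []
  mapℤ (a ∷ cs) = fromℤ a ∷ mapℤ cs

-- The field of real algebraic numbers, characterised (uniquely up to
-- isomorphism) as an ordered field which is real closed and every element
-- of which is algebraic over ℚ (i.e. a root of a nonzero integer polynomial).

record RealAlgebraicNumbers c ℓ : Set (lsuc (c ⊔ ℓ)) where
  field
    commRing : CommutativeRing c ℓ
  open CommutativeRing commRing public
  open Poly commRing public
  infix 4 _<_
  field
    _<_        : Rel Carrier ℓ
    <-irrefl   : ∀ {x y} → x ≈ y → ¬ (x < y)
    <-trans    : ∀ {x y z} → x < y → y < z → x < z
    <-trichotomy : ∀ x y → x < y ⊎ x ≈ y ⊎ y < x
    <-resp-≈   : ∀ {x x′ y y′} → x ≈ x′ → y ≈ y′ → x < y → x′ < y′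
    +-mono-<   : ∀ {x y} z → x < y → x + z < y + z
    *-pos      : ∀ {x y} → 0# < x → 0# < y → 0# < x * y
    0<1        : 0# < 1#
    _⁻¹        : Carrier → Carrier
    ⁻¹-inverse : ∀ x → ¬ (x ≈ 0#) → x * (x ⁻¹) ≈ 1#
    -- real closed: positive elements have square roots, and every monic
    -- polynomial of odd degree has a root
    sqrt-exists : ∀ x → 0# < x → ∃ λ y → y * y ≈ x
    odd-root    : ∀ (n : ℕ) (cs : List Carrier) → length cs ≡ suc (n *ℕ 2) →
                  ∃ λ x → eval (cs ++ [ 1# ]) x ≈ 0#
    algebraic   : ∀ x → ∃ λ (p : List ℤ) →
                  Any (λ a → ¬ (a ≡ + 0)) p × eval (mapℤ p) x ≈ 0#

module Complex {c ℓ} (R : RealAlgebraicNumbers c ℓ) where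
  open RealAlgebraicNumbers R

  record ℂ : Set c where
    constructor _+i_
    field re im : Carrier
  open ℂ public

  infix 4 _≈ℂ_
  infixl 6 _+ℂ_ _-ℂ_
  infixl 7 _*ℂ_ _/ℂ_
  infixr 8 _^ℂ_

  _≈ℂ_ : ℂ → ℂ → Set ℓ
  z ≈ℂ w = (re z ≈ re w) × (im z ≈ im w)

  0ℂ 1ℂ 2ℂ : ℂ
  0ℂ = 0# +i 0#
  1ℂ = 1# +i 0#
  2ℂ = (1# + 1#) +i 0#

  _+ℂ_ _-ℂ_ _*ℂ_ _/ℂ_ : ℂ → ℂ → ℂ
  (a +i b) +ℂ (c′ +i d) = (a + c′) +i (b + d)
  (a +i b) -ℂ (c′ +i d) = (a - c′) +i (b - d)
  (a +i b) *ℂ (c′ +i d) = (a * c′ - b * d) +i (a * d + b * c′)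
  z /ℂ (c′ +i d) = z *ℂ ((c′ * n⁻¹) +i (- (d * n⁻¹)))
    where n⁻¹ = (c′ * c′ + d * d) ⁻¹

  _^ℂ_ : ℂ → ℕ → ℂ
  z ^ℂ zero  = 1ℂ
  z ^ℂ suc k = z *ℂ (z ^ℂ k)

  thicken : ℕ → ℂ → ℂ
  thicken k w = w ^ℂ k

  stretchBase : ℕ → ℂ → ℂ
  stretchBase k w = ((w +ℂ 1ℂ) /ℂ (w -ℂ 1ℂ)) ^ℂ k

  stretch : ℕ → ℂ → ℂ
  stretch k w = 1ℂ +ℂ (2ℂ /ℂ (stretchBase k w -ℂ 1ℂ))

  -- Obtainable y z : z arises from y by a finite sequence of k-stretchings
  -- and k-thickenings (k ≥ 1), each applied only where defined.
  data Obtainable (y : ℂ) : ℂ → Set (c ⊔ ℓ) where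
    done    : Obtainable y y
    thick   : ∀ {w} (k : ℕ) → Obtainable y w → Obtainable y (thicken (suc k) w)
    stretch′ : ∀ {w} (k : ℕ) → Obtainable y w →
              ¬ (w ≈ℂ 1ℂ) → ¬ (stretchBase (suc k) w -ℂ 1ℂ ≈ℂ 0ℂ) →
              Obtainable y (stretch (suc k) w)

-- Write r = cot φ. The k-stretch sends the imaginary point i cot φ to i cot (kφ), and
-- the 2-thickening sends i s to -s², which lies in (-1, 0) once 0 < s² < 1. While
-- s² > 1, the 2-stretch s ↦ (s² - 1)/2s lowers s² by more than 1, so by the
-- Archimedean property (for real algebraic numbers a consequence of Cauchy's bound on
-- the roots of an integer polynomial) s² drops below 1 after finitely many steps.
-- Should it land on s² = 1 exactly (cot 2φ = ±1), the 3-stretch of the previous point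
-- is used instead, and indeed cot² 3φ = (√2 - 1)² < 1.

module Submission where

open import Defs
open import Algebra.Bundles using (CommutativeRing; CommutativeMonoid)
open import Data.Empty using (⊥-elim)
open import Data.Integer as ℤ using (ℤ; +_; -[1+_]; _⊖_; ∣_∣)
import Data.Integer.Properties as ℤ
open import Data.List using (List; []; _∷_; map)
open import Data.List.Extrema.Nat using (max; xs≤max)
open import Data.List.Relation.Unary.All using (All; []; _∷_; lookupWith)
open import Data.List.Relation.Unary.All.Properties using (map⁻)
open import Data.Maybe using (Maybe; just; nothing)
open import Data.Nat as ℕ using (ℕ; zero; suc)
import Data.Nat.Properties as ℕ
open import Data.Product using (∃; _×_; _,_; proj₁; proj₂)
open import Data.Sum using (_⊎_; inj₁; inj₂; [_,_])
open import Level using (_⊔_)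
open import Relation.Binary.Bundles using (StrictPartialOrder)
open import Relation.Binary.Structures using (IsEquivalence; IsStrictPartialOrder)
open import Relation.Binary.PropositionalEquality as ≡ using (_≡_)
open import Relation.Nullary using (¬_; Dec; yes; no)
import Algebra.Solver.Ring.AlmostCommutativeRing as ACR
import Relation.Binary.Construct.StrictToNonStrict as StrictToNonStrict
import Relation.Binary.Reasoning.StrictPartialOrder as StrictPartialOrderReasoning

-- Unlike Poly.fromℤ, fromℤ′ sends 0 and 1 to 0# and 1# themselves, so that the
-- solver's constants unfold to the constants occurring in 0ℂ, 1ℂ and _^ℂ_.
module IntegerCoefficients {c ℓ} (R : CommutativeRing c ℓ) where
  open CommutativeRing R
  open import Algebra.Properties.Ring ring
    using (-0#≈0#; -‿involutive; -‿+-comm; -‿distribˡ-*; -‿distribʳ-*)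
  open import Algebra.Properties.Semiring.Mult.TCOptimised semiring
    using (×-homo-+; ×1-homo-*; 1+×) renaming (_×_ to _×ₘ_)
  open import Algebra.Properties.CommutativeSemigroup +-commutativeSemigroup using (interchange)
  open import Relation.Binary.Reasoning.Setoid setoid

  fromℕ′ : ℕ → Carrier
  fromℕ′ n = n ×ₘ 1#

  fromℤ′ : ℤ → Carrier
  fromℤ′ (+ n)    = fromℕ′ n
  fromℤ′ -[1+ n ] = - fromℕ′ (suc n)

  private
    x+a-[x+b]≈a-b : ∀ x a b → (x + a) - (x + b) ≈ a - b
    x+a-[x+b]≈a-b x a b = begin
      (x + a) - (x + b)    ≈⟨ +-congˡ (-‿+-comm x b) ⟨
      (x + a) + (- x - b)  ≈⟨ interchange x a (- x) (- b) ⟩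
      (x - x) + (a - b)    ≈⟨ +-congʳ (-‿inverseʳ x) ⟩
      0# + (a - b)         ≈⟨ +-identityˡ _ ⟩
      a - b                ∎

  fromℤ′-⊖ : ∀ m n → fromℤ′ (m ⊖ n) ≈ fromℕ′ m - fromℕ′ n
  fromℤ′-⊖ m       zero    = sym (trans (+-congˡ -0#≈0#) (+-identityʳ _))
  fromℤ′-⊖ zero    (suc n) = sym (+-identityˡ _)
  fromℤ′-⊖ (suc m) (suc n) = begin
    fromℤ′ (suc m ⊖ suc n)             ≡⟨ ≡.cong fromℤ′ (ℤ.[1+m]⊖[1+n]≡m⊖n m n) ⟩
    fromℤ′ (m ⊖ n)                     ≈⟨ fromℤ′-⊖ m n ⟩
    fromℕ′ m - fromℕ′ n                ≈⟨ x+a-[x+b]≈a-b 1# _ _ ⟨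
    (1# + fromℕ′ m) - (1# + fromℕ′ n)  ≈⟨ +-cong (1+× m 1#) (-‿cong (1+× n 1#)) ⟨
    fromℕ′ (suc m) - fromℕ′ (suc n)    ∎

  fromℤ′-+ : ∀ i j → fromℤ′ (i ℤ.+ j) ≈ fromℤ′ i + fromℤ′ j
  fromℤ′-+ (+ m)    (+ n)    = ×-homo-+ 1# m n
  fromℤ′-+ (+ m)    -[1+ n ] = fromℤ′-⊖ m (suc n)
  fromℤ′-+ -[1+ m ] (+ n)    = trans (fromℤ′-⊖ n (suc m)) (+-comm _ _)
  fromℤ′-+ -[1+ m ] -[1+ n ] = begin
    - fromℕ′ (suc (suc (m ℕ.+ n)))       ≡⟨ ≡.cong (λ k → - fromℕ′ (suc k)) (ℕ.+-suc m n) ⟨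
    - fromℕ′ (suc m ℕ.+ suc n)           ≈⟨ -‿cong (×-homo-+ 1# (suc m) (suc n)) ⟩
    - (fromℕ′ (suc m) + fromℕ′ (suc n))  ≈⟨ -‿+-comm _ _ ⟨
    - fromℕ′ (suc m) - fromℕ′ (suc n)    ∎

  fromℤ′-neg : ∀ i → fromℤ′ (ℤ.- i) ≈ - fromℤ′ i
  fromℤ′-neg (+ zero)  = sym -0#≈0#
  fromℤ′-neg (+ suc n) = refl
  fromℤ′-neg -[1+ n ]  = sym (-‿involutive _)

  fromℤ′-*-pos : ∀ m j → fromℤ′ (+ m ℤ.* j) ≈ fromℕ′ m * fromℤ′ j
  fromℤ′-*-pos m (+ n) = begin
    fromℤ′ (+ m ℤ.* + n)  ≡⟨ ≡.cong fromℤ′ (ℤ.pos-* m n) ⟨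
    fromℕ′ (m ℕ.* n)      ≈⟨ ×1-homo-* m n ⟩
    fromℕ′ m * fromℕ′ n   ∎
  fromℤ′-*-pos m -[1+ n ] = begin
    fromℤ′ (+ m ℤ.* -[1+ n ])       ≡⟨ ≡.cong fromℤ′ (ℤ.neg-distribʳ-* (+ m) (+ suc n)) ⟨
    fromℤ′ (ℤ.- (+ m ℤ.* + suc n))  ≈⟨ fromℤ′-neg (+ m ℤ.* + suc n) ⟩
    - fromℤ′ (+ m ℤ.* + suc n)      ≈⟨ -‿cong (fromℤ′-*-pos m (+ suc n)) ⟩
    - (fromℕ′ m * fromℕ′ (suc n))   ≈⟨ -‿distribʳ-* _ _ ⟩
    fromℕ′ m * - fromℕ′ (suc n)     ∎

  fromℤ′-* : ∀ i j → fromℤ′ (i ℤ.* j) ≈ fromℤ′ i * fromℤ′ j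
  fromℤ′-* (+ m)    j = fromℤ′-*-pos m j
  fromℤ′-* -[1+ m ] j = begin
    fromℤ′ (-[1+ m ] ℤ.* j)        ≡⟨ ≡.cong fromℤ′ (ℤ.neg-distribˡ-* (+ suc m) j) ⟨
    fromℤ′ (ℤ.- (+ suc m ℤ.* j))   ≈⟨ fromℤ′-neg (+ suc m ℤ.* j) ⟩
    - fromℤ′ (+ suc m ℤ.* j)       ≈⟨ -‿cong (fromℤ′-*-pos (suc m) j) ⟩
    - (fromℕ′ (suc m) * fromℤ′ j)  ≈⟨ -‿distribˡ-* _ _ ⟩
    - fromℕ′ (suc m) * fromℤ′ j    ∎

  fromℤ′-homomorphism : ℤ.+-*-rawRing ACR.-Raw-AlmostCommutative⟶ ACR.fromCommutativeRing R
  fromℤ′-homomorphism = record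
    { ⟦_⟧    = fromℤ′
    ; +-homo = fromℤ′-+
    ; *-homo = fromℤ′-*
    ; -‿homo = fromℤ′-neg
    ; 0-homo = refl
    ; 1-homo = refl
    }

  private
    fromℤ′-≟ : ∀ i j → Maybe (fromℤ′ i ≈ fromℤ′ j)
    fromℤ′-≟ i j with i ℤ.≟ j
    ... | yes ≡.refl = just refl
    ... | no _       = nothing

  open import Algebra.Solver.Ring ℤ.+-*-rawRing (ACR.fromCommutativeRing R)
    fromℤ′-homomorphism fromℤ′-≟ public

module OrderedField {c ℓ} (R : RealAlgebraicNumbers c ℓ) where
  open RealAlgebraicNumbers R
  open IntegerCoefficients commRing using (fromℕ′; solve; _:=_; con; _:+_; _:*_; _:-_; :-_)
  open import Algebra.Properties.Ring ring using (-0#≈0#)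
  open import Algebra.Properties.Group +-group
    using (x∙y⁻¹≈ε⇒x≈y; x≈y⇒x∙y⁻¹≈ε; inverseˡ-unique)

  <-isStrictPartialOrder : IsStrictPartialOrder _≈_ _<_
  <-isStrictPartialOrder = record
    { isEquivalence = isEquivalence
    ; irrefl        = <-irrefl
    ; trans         = <-trans
    ; <-resp-≈      = (λ e → <-resp-≈ refl e) , (λ e → <-resp-≈ e refl)
    }

  <-strictPartialOrder : StrictPartialOrder c ℓ ℓ
  <-strictPartialOrder = record { isStrictPartialOrder = <-isStrictPartialOrder }

  open StrictToNonStrict _≈_ _<_ public using (_≤_; <⇒≤)
  open StrictPartialOrderReasoning <-strictPartialOrder public

  <⇒≉ : ∀ {x y} → x < y → ¬ x ≈ y
  <⇒≉ x<y x≈y = <-irrefl x≈y x<y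

  <-asym : ∀ {x y} → x < y → ¬ y < x
  <-asym x<y y<x = <-irrefl refl (<-trans x<y y<x)

  ≤⇒≯ : ∀ {x y} → x ≤ y → ¬ y < x
  ≤⇒≯ (inj₁ x<y) = <-asym x<y
  ≤⇒≯ (inj₂ x≈y) = <-irrefl (sym x≈y)

  ≈0? : ∀ x → x ≈ 0# ⊎ ¬ x ≈ 0#
  ≈0? x with <-trichotomy x 0#
  ... | inj₁ x<0        = inj₂ (<⇒≉ x<0)
  ... | inj₂ (inj₁ x≈0) = inj₁ x≈0
  ... | inj₂ (inj₂ 0<x) = inj₂ (λ x≈0 → <⇒≉ 0<x (sym x≈0))

  x<y⇒0<y-x : ∀ {x y} → x < y → 0# < y - x
  x<y⇒0<y-x {x} x<y = <-resp-≈ (-‿inverseʳ x) refl (+-mono-< (- x) x<y)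

  0<y-x⇒x<y : ∀ {x y} → 0# < y - x → x < y
  0<y-x⇒x<y {x} {y} 0<y-x = <-resp-≈ (+-identityˡ x) (y-x+x≈y y x) (+-mono-< x 0<y-x)
    where
    y-x+x≈y : ∀ y x → y - x + x ≈ y
    y-x+x≈y = solve 2 (λ y x → y :- x :+ x := y) refl

  +-monoʳ-< : ∀ z {x y} → x < y → z + x < z + y
  +-monoʳ-< z {x} {y} x<y = <-resp-≈ (+-comm x z) (+-comm y z) (+-mono-< z x<y)

  neg-antimono-< : ∀ {x y} → x < y → - y < - x
  neg-antimono-< {x} {y} x<y = 0<y-x⇒x<y (<-resp-≈ refl (difference x y) (x<y⇒0<y-x x<y))
    where
    difference : ∀ x y → y - x ≈ - x - - y
    difference = solve 2 (λ x y → y :- x := :- x :- :- y) refl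

  *-monoˡ-<-pos : ∀ {z x y} → 0# < z → x < y → x * z < y * z
  *-monoˡ-<-pos {z} {x} {y} 0<z x<y =
    0<y-x⇒x<y (<-resp-≈ refl ([y-x]*z≈y*z-x*z x y z) (*-pos (x<y⇒0<y-x x<y) 0<z))
    where
    [y-x]*z≈y*z-x*z : ∀ x y z → (y - x) * z ≈ y * z - x * z
    [y-x]*z≈y*z-x*z = solve 3 (λ x y z → (y :- x) :* z := y :* z :- x :* z) refl

  *-cancelʳ-<-pos : ∀ {z x y} → 0# < z → x * z < y * z → x < y
  *-cancelʳ-<-pos {z} {x} {y} 0<z xz<yz with <-trichotomy x y
  ... | inj₁ x<y        = x<y
  ... | inj₂ (inj₁ x≈y) = ⊥-elim (<-irrefl (*-congʳ x≈y) xz<yz)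
  ... | inj₂ (inj₂ y<x) = ⊥-elim (<-asym (*-monoˡ-<-pos 0<z y<x) xz<yz)

  +-pos : ∀ {x y} → 0# < x → 0# ≤ y → 0# < x + y
  +-pos {x} {y} 0<x 0≤y = begin-strict
    0#       ≈⟨ +-identityʳ 0# ⟨
    0# + 0#  <⟨ +-mono-< 0# 0<x ⟩
    x + 0#   ≤⟨ +-monoʳ-≤ 0≤y ⟩
    x + y    ∎
    where
    +-monoʳ-≤ : ∀ {u v} → u ≤ v → x + u ≤ x + v
    +-monoʳ-≤ (inj₁ u<v) = inj₁ (+-monoʳ-< x u<v)
    +-monoʳ-≤ (inj₂ u≈v) = inj₂ (+-congˡ u≈v)

  0<fromℕ′-suc : ∀ n → 0# < fromℕ′ (suc n)
  0<fromℕ′-suc zero    = 0<1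
  0<fromℕ′-suc (suc n) = +-pos (0<fromℕ′-suc n) (<⇒≤ 0<1)

  x≉0⇒0<x*x : ∀ {x} → ¬ x ≈ 0# → 0# < x * x
  x≉0⇒0<x*x {x} x≉0 with <-trichotomy x 0#
  ... | inj₁ x<0        = <-resp-≈ refl (-x*-x≈x*x x) (*-pos 0<-x 0<-x)
    where
    0<-x : 0# < - x
    0<-x = <-resp-≈ -0#≈0# refl (neg-antimono-< x<0)
    -x*-x≈x*x : ∀ x → - x * - x ≈ x * x
    -x*-x≈x*x = solve 1 (λ x → :- x :* :- x := x :* x) refl
  ... | inj₂ (inj₁ x≈0) = ⊥-elim (x≉0 x≈0)
  ... | inj₂ (inj₂ 0<x) = *-pos 0<x 0<x

  0≤x*x : ∀ x → 0# ≤ x * x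
  0≤x*x x with ≈0? x
  ... | inj₁ x≈0 = inj₂ (sym (trans (*-congʳ x≈0) (zeroˡ x)))
  ... | inj₂ x≉0 = inj₁ (x≉0⇒0<x*x x≉0)

  1<x*x⇒x≉0 : ∀ {x} → 1# < x * x → ¬ x ≈ 0#
  1<x*x⇒x≉0 {x} 1<x² x≈0 = <-asym 0<1 (<-resp-≈ refl (trans (*-congʳ x≈0) (zeroˡ x)) 1<x²)

  x*x+y*y≈0⇒x≈0 : ∀ {x y} → x * x + y * y ≈ 0# → x ≈ 0#
  x*x+y*y≈0⇒x≈0 {x} {y} sum≈0 with ≈0? x
  ... | inj₁ x≈0 = x≈0
  ... | inj₂ x≉0 = ⊥-elim (<⇒≉ (+-pos (x≉0⇒0<x*x x≉0) (0≤x*x y)) (sym sum≈0))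

  y*x⁻¹*x≈y : ∀ {x} y → ¬ x ≈ 0# → y * x ⁻¹ * x ≈ y
  y*x⁻¹*x≈y {x} y x≉0 = begin-equality
    y * x ⁻¹ * x    ≈⟨ *-assoc y (x ⁻¹) x ⟩
    y * (x ⁻¹ * x)  ≈⟨ *-congˡ (*-comm (x ⁻¹) x) ⟩
    y * (x * x ⁻¹)  ≈⟨ *-congˡ (⁻¹-inverse x x≉0) ⟩
    y * 1#          ≈⟨ *-identityʳ y ⟩
    y               ∎

  x*y≈0⇒y≈0 : ∀ {x y} → ¬ x ≈ 0# → x * y ≈ 0# → y ≈ 0#
  x*y≈0⇒y≈0 {x} {y} x≉0 xy≈0 = begin-equality
    y               ≈⟨ y*x⁻¹*x≈y y x≉0 ⟨
    y * x ⁻¹ * x    ≈⟨ *-comm _ x ⟩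
    x * (y * x ⁻¹)  ≈⟨ *-assoc x y (x ⁻¹) ⟨
    x * y * x ⁻¹    ≈⟨ *-congʳ xy≈0 ⟩
    0# * x ⁻¹       ≈⟨ zeroˡ _ ⟩
    0#              ∎

  *-≉0 : ∀ {x y} → ¬ x ≈ 0# → ¬ y ≈ 0# → ¬ x * y ≈ 0#
  *-≉0 x≉0 y≉0 xy≈0 = y≉0 (x*y≈0⇒y≈0 x≉0 xy≈0)

  x≈y+r∧r≈0⇒x≈y : ∀ {x y r} → x ≈ y + r → r ≈ 0# → x ≈ y
  x≈y+r∧r≈0⇒x≈y {y = y} x≈y+r r≈0 = trans x≈y+r (trans (+-congˡ r≈0) (+-identityʳ y))

  x<1+y⇒x-1<y : ∀ {x y} → x < 1# + y → x - 1# < y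
  x<1+y⇒x-1<y {x} {y} x<1+y = 0<y-x⇒x<y (<-resp-≈ refl (shift x y) (x<y⇒0<y-x x<1+y))
    where
    shift : ∀ x y → 1# + y - x ≈ y - (x - 1#)
    shift = solve 2 (λ x y → con (+ 1) :+ y :- x := y :- (x :- con (+ 1))) refl

  x*x≈1⇒x≈1⊎x≈-1 : ∀ {x} → x * x ≈ 1# → x ≈ 1# ⊎ x ≈ - 1#
  x*x≈1⇒x≈1⊎x≈-1 {x} x²≈1 with ≈0? (x - 1#)
  ... | inj₁ x-1≈0 = inj₁ (x∙y⁻¹≈ε⇒x≈y x 1# x-1≈0)
  ... | inj₂ x-1≉0 =
    inj₂ (inverseˡ-unique x 1# (x*y≈0⇒y≈0 x-1≉0 (trans (factor x) (x≈y⇒x∙y⁻¹≈ε x²≈1))))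
    where
    factor : ∀ x → (x - 1#) * (x + 1#) ≈ x * x - 1#
    factor = solve 1 (λ x → (x :- con (+ 1)) :* (x :+ con (+ 1)) := x :* x :- con (+ 1)) refl

module Archimedean {c ℓ} (R : RealAlgebraicNumbers c ℓ) where
  open RealAlgebraicNumbers R
  open OrderedField R
  open IntegerCoefficients commRing using (solve; _:=_; con; _:+_; :-_)
  open import Algebra.Properties.Ring ring using (-0#≈0#; -1*x≈-x)

  +-mono-≤ : ∀ {x y u v} → x ≤ y → u ≤ v → x + u ≤ y + v
  +-mono-≤ {x} {y} {u} {v} x≤y u≤v = begin
    x + u  ≤⟨ +-monoˡ-≤ x≤y ⟩
    y + u  ≈⟨ +-comm y u ⟩
    u + y  ≤⟨ +-monoˡ-≤ u≤v ⟩
    v + y  ≈⟨ +-comm v y ⟩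
    y + v  ∎
    where
    +-monoˡ-≤ : ∀ {z a b} → a ≤ b → a + z ≤ b + z
    +-monoˡ-≤ {z} (inj₁ a<b) = inj₁ (+-mono-< z a<b)
    +-monoˡ-≤     (inj₂ a≈b) = inj₂ (+-congʳ a≈b)

  neg-antimono-≤ : ∀ {x y} → x ≤ y → - y ≤ - x
  neg-antimono-≤ (inj₁ x<y) = inj₁ (neg-antimono-< x<y)
  neg-antimono-≤ (inj₂ x≈y) = inj₂ (-‿cong (sym x≈y))

  *-monoʳ-≤-pos : ∀ {z x y} → 0# < z → x ≤ y → z * x ≤ z * y
  *-monoʳ-≤-pos {z} {x} {y} 0<z (inj₁ x<y) =
    inj₁ (<-resp-≈ (*-comm x z) (*-comm y z) (*-monoˡ-<-pos 0<z x<y))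
  *-monoʳ-≤-pos 0<z (inj₂ x≈y) = inj₂ (*-congˡ x≈y)

  0≤fromℕ : ∀ n → 0# ≤ fromℕ n
  0≤fromℕ zero    = inj₂ refl
  0≤fromℕ (suc n) = <⇒≤ (+-pos 0<1 (0≤fromℕ n))

  fromℕ-mono-≤ : ∀ {m n} → m ℕ.≤ n → fromℕ m ≤ fromℕ n
  fromℕ-mono-≤ {n = n} ℕ.z≤n       = 0≤fromℕ n
  fromℕ-mono-≤         (ℕ.s≤s m≤n) = +-mono-≤ (inj₂ refl) (fromℕ-mono-≤ m≤n)

  1≤fromℕ-suc : ∀ n → 1# ≤ fromℕ (suc n)
  1≤fromℕ-suc n = begin
    1#            ≈⟨ +-identityʳ 1# ⟨
    1# + 0#       ≤⟨ +-mono-≤ (inj₂ refl) (0≤fromℕ n) ⟩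
    1# + fromℕ n  ∎

  -fromℕ≤0 : ∀ n → - fromℕ n ≤ 0#
  -fromℕ≤0 n = begin
    - fromℕ n  ≤⟨ neg-antimono-≤ (0≤fromℕ n) ⟩
    - 0#       ≈⟨ -0#≈0# ⟩
    0#         ∎

  fromℤ-lower : ∀ a {M} → ∣ a ∣ ℕ.≤ M → - fromℕ M ≤ fromℤ a
  fromℤ-lower (+ n)    {M} _    = begin
    - fromℕ M  ≤⟨ -fromℕ≤0 M ⟩
    0#         ≤⟨ 0≤fromℕ n ⟩
    fromℕ n    ∎
  fromℤ-lower -[1+ n ]     ∣a∣≤M = neg-antimono-≤ (fromℕ-mono-≤ ∣a∣≤M)

  fromℤ-upper : ∀ a {M} → ∣ a ∣ ℕ.≤ M → fromℤ a ≤ fromℕ M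
  fromℤ-upper (+ n)        ∣a∣≤M = fromℕ-mono-≤ ∣a∣≤M
  fromℤ-upper -[1+ n ] {M} _    = begin
    - fromℕ (suc n)  ≤⟨ -fromℕ≤0 (suc n) ⟩
    0#               ≤⟨ 0≤fromℕ M ⟩
    fromℕ M          ∎

  fromℤ-apart : ∀ {a} → ¬ a ≡ + 0 → 1# ≤ fromℤ a ⊎ fromℤ a ≤ - 1#
  fromℤ-apart {+ zero}     a≢0 = ⊥-elim (a≢0 ≡.refl)
  fromℤ-apart {+ suc n}    _   = inj₁ (1≤fromℕ-suc n)
  fromℤ-apart { -[1+ n ] } _   = inj₂ (neg-antimono-≤ (1≤fromℕ-suc n))

  eval-zeros : ∀ cs x → All (_≡ + 0) cs → eval (mapℤ cs) x ≈ 0#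
  eval-zeros []       x []               = refl
  eval-zeros (_ ∷ cs) x (≡.refl ∷ zeros) = begin-equality
    0# + x * eval (mapℤ cs) x  ≈⟨ +-identityˡ _ ⟩
    x * eval (mapℤ cs) x       ≈⟨ *-congˡ (eval-zeros cs x zeros) ⟩
    x * 0#                     ≈⟨ zeroʳ x ⟩
    0#                         ∎

  ZeroOrUnitApart : Carrier → List ℤ → Set ℓ
  ZeroOrUnitApart X cs = All (_≡ + 0) cs ⊎ 1# ≤ eval (mapℤ cs) X ⊎ eval (mapℤ cs) X ≤ - 1#

  -- Beyond 1 + M, where M bounds the coefficients, the highest nonzero coefficient
  -- dominates, so a nonzero polynomial stays outside (-1, 1).
  eval-apart : ∀ {X M} → 1# + fromℕ M ≤ X →
               ∀ cs → All (λ a → ∣ a ∣ ℕ.≤ M) cs → ZeroOrUnitApart X cs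
  eval-apart _ [] [] = inj₁ []
  eval-apart {X} {M} M+1≤X (a ∷ cs) (∣a∣≤M ∷ bounded) = extend (eval-apart M+1≤X cs bounded)
    where
    v : Carrier
    v = eval (mapℤ cs) X

    0<X : 0# < X
    0<X = begin-strict
      0#            <⟨ +-pos 0<1 (0≤fromℕ M) ⟩
      1# + fromℕ M  ≤⟨ M+1≤X ⟩
      X             ∎

    constant : All (_≡ + 0) cs → Dec (a ≡ + 0) → ZeroOrUnitApart X (a ∷ cs)
    constant zeros (yes a≡0) = inj₁ (a≡0 ∷ zeros)
    constant zeros (no a≢0)  =
      [ (λ 1≤a  → inj₂ (inj₁ (begin 1# ≤⟨ 1≤a ⟩ fromℤ a ≈⟨ value≈a ⟨ _ ∎)))
      , (λ a≤-1 → inj₂ (inj₂ (begin _ ≈⟨ value≈a ⟩ fromℤ a ≤⟨ a≤-1 ⟩ - 1# ∎)))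
      ] (fromℤ-apart a≢0)
      where
      value≈a : fromℤ a + X * v ≈ fromℤ a
      value≈a = trans (+-congˡ (trans (*-congˡ (eval-zeros cs X zeros)) (zeroʳ X))) (+-identityʳ _)

    extend : ZeroOrUnitApart X cs → ZeroOrUnitApart X (a ∷ cs)
    extend (inj₁ zeros)       = constant zeros (a ℤ.≟ + 0)
    extend (inj₂ (inj₁ 1≤v))  = inj₂ (inj₁ (begin
      1#                          ≈⟨ -m+[1+m]≈1 (fromℕ M) ⟨
      - fromℕ M + (1# + fromℕ M)  ≤⟨ +-mono-≤ (fromℤ-lower a ∣a∣≤M) M+1≤X ⟩
      fromℤ a + X                 ≈⟨ +-congˡ (*-identityʳ X) ⟨
      fromℤ a + X * 1#            ≤⟨ +-mono-≤ (inj₂ refl) (*-monoʳ-≤-pos 0<X 1≤v) ⟩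
      fromℤ a + X * v             ∎))
      where
      -m+[1+m]≈1 : ∀ m → - m + (1# + m) ≈ 1#
      -m+[1+m]≈1 = solve 1 (λ m → :- m :+ (con (+ 1) :+ m) := con (+ 1)) refl
    extend (inj₂ (inj₂ v≤-1)) = inj₂ (inj₂ (begin
      fromℤ a + X * v             ≤⟨ +-mono-≤ (inj₂ refl) (*-monoʳ-≤-pos 0<X v≤-1) ⟩
      fromℤ a + X * - 1#          ≈⟨ +-congˡ (trans (*-comm X _) (-1*x≈-x X)) ⟩
      fromℤ a + - X               ≤⟨ +-mono-≤ (fromℤ-upper a ∣a∣≤M) (neg-antimono-≤ M+1≤X) ⟩
      fromℕ M + - (1# + fromℕ M)  ≈⟨ m-[1+m]≈-1 (fromℕ M) ⟩
      - 1#                        ∎))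
      where
      m-[1+m]≈-1 : ∀ m → m + - (1# + m) ≈ - 1#
      m-[1+m]≈-1 = solve 1 (λ m → m :+ :- (con (+ 1) :+ m) := :- con (+ 1)) refl

  archimedean : ∀ x → ∃ λ N → x < fromℕ N
  archimedean x with algebraic x
  ... | p , nonzero , root = bound-or-absurd (<-trichotomy x (fromℕ (suc M)))
    where
    M : ℕ
    M = max 0 (map ∣_∣ p)

    bounded : All (λ a → ∣ a ∣ ℕ.≤ M) p
    bounded = map⁻ (xs≤max 0 (map ∣_∣ p))

    not-root : ¬ ZeroOrUnitApart x p
    not-root (inj₁ zeros)       = lookupWith (λ a≡0 a≢0 → a≢0 a≡0) zeros nonzero
    not-root (inj₂ (inj₁ 1≤v))  = ≤⇒≯ (begin 1# ≤⟨ 1≤v ⟩ _ ≈⟨ root ⟩ 0# ∎) 0<1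
    not-root (inj₂ (inj₂ v≤-1)) = ≤⇒≯ (begin 0# ≈⟨ root ⟨ _ ≤⟨ v≤-1 ⟩ - 1# ∎) -1<0
      where
      -1<0 : - 1# < 0#
      -1<0 = <-resp-≈ refl -0#≈0# (neg-antimono-< 0<1)

    bound-or-absurd : x < fromℕ (suc M) ⊎ x ≈ fromℕ (suc M) ⊎ fromℕ (suc M) < x →
                      ∃ λ N → x < fromℕ N
    bound-or-absurd (inj₁ x<N)        = suc M , x<N
    bound-or-absurd (inj₂ (inj₁ x≈N)) = ⊥-elim (not-root (eval-apart (inj₂ (sym x≈N)) p bounded))
    bound-or-absurd (inj₂ (inj₂ N<x)) = ⊥-elim (not-root (eval-apart (inj₁ N<x) p bounded))

module ComplexArithmetic {c ℓ} (R : RealAlgebraicNumbers c ℓ) where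
  open RealAlgebraicNumbers R
  open OrderedField R using (x*x+y*y≈0⇒x≈0)
  open IntegerCoefficients commRing
    using (fromℕ′; Polynomial; solve; _:=_; con; _:+_; _:*_; _:-_; :-_)
  open import Algebra.Properties.Ring ring using (-0#≈0#)
  open Complex R

  -- The operations of ℂ on pairs of solver expressions: their denotations unfold to
  -- the components of the operations on ℂ, so componentwise identities are solver goals.
  infixl 7 _:*ℂ_
  infixl 6 _:+ℂ_ _:-ℂ_

  _:*ℂ_ _:+ℂ_ _:-ℂ_ : ∀ {n} → Polynomial n × Polynomial n → Polynomial n × Polynomial n →
                      Polynomial n × Polynomial n
  (a , b) :*ℂ (c , d) = a :* c :- b :* d , a :* d :+ b :* c
  (a , b) :+ℂ (c , d) = a :+ c , b :+ d
  (a , b) :-ℂ (c , d) = a :- c , b :- d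

  :0ℂ :1ℂ :iℂ : ∀ {n} → Polynomial n × Polynomial n
  :0ℂ = con (+ 0) , con (+ 0)
  :1ℂ = con (+ 1) , con (+ 0)
  :iℂ = con (+ 0) , con (+ 1)

  :conj : ∀ {n} → Polynomial n × Polynomial n → Polynomial n × Polynomial n
  :conj (a , b) = a , :- b

  iℂ : ℂ
  iℂ = 0# +i 1#

  conj : ℂ → ℂ
  conj (a +i b) = a +i (- b)

  normSq : ℂ → Carrier
  normSq z = re z * re z + im z * im z

  recip : ℂ → ℂ
  recip u = (re u * normSq u ⁻¹) +i (- (im u * normSq u ⁻¹))

  ≈ℂ-isEquivalence : IsEquivalence _≈ℂ_
  ≈ℂ-isEquivalence = record
    { refl  = refl , refl
    ; sym   = λ (e , f) → sym e , sym f
    ; trans = λ (e , f) (e′ , f′) → trans e e′ , trans f f′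
    }

  open IsEquivalence ≈ℂ-isEquivalence public using ()
    renaming (refl to ≈ℂ-refl; sym to ≈ℂ-sym; trans to ≈ℂ-trans)

  *ℂ-cong : ∀ {x x′ y y′} → x ≈ℂ x′ → y ≈ℂ y′ → x *ℂ y ≈ℂ x′ *ℂ y′
  *ℂ-cong (a , b) (c , d) = +-cong (*-cong a c) (-‿cong (*-cong b d)) , +-cong (*-cong a d) (*-cong b c)

  +ℂ-cong : ∀ {x x′ y y′} → x ≈ℂ x′ → y ≈ℂ y′ → x +ℂ y ≈ℂ x′ +ℂ y′
  +ℂ-cong (a , b) (c , d) = +-cong a c , +-cong b d

  -ℂ-cong : ∀ {x x′ y y′} → x ≈ℂ x′ → y ≈ℂ y′ → x -ℂ y ≈ℂ x′ -ℂ y′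
  -ℂ-cong (a , b) (c , d) = +-cong a (-‿cong c) , +-cong b (-‿cong d)

  *ℂ-assoc : ∀ x y z → (x *ℂ y) *ℂ z ≈ℂ x *ℂ (y *ℂ z)
  *ℂ-assoc (a +i b) (c +i d) (e +i f) =
      solve 6 (λ a b c d e f → proj₁ ((a , b) :*ℂ (c , d) :*ℂ (e , f))
                              := proj₁ ((a , b) :*ℂ ((c , d) :*ℂ (e , f)))) refl a b c d e f
    , solve 6 (λ a b c d e f → proj₂ ((a , b) :*ℂ (c , d) :*ℂ (e , f))
                              := proj₂ ((a , b) :*ℂ ((c , d) :*ℂ (e , f)))) refl a b c d e f

  *ℂ-comm : ∀ x y → x *ℂ y ≈ℂ y *ℂ x
  *ℂ-comm (a +i b) (c +i d) =
      solve 4 (λ a b c d → proj₁ ((a , b) :*ℂ (c , d)) := proj₁ ((c , d) :*ℂ (a , b))) refl a b c d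
    , solve 4 (λ a b c d → proj₂ ((a , b) :*ℂ (c , d)) := proj₂ ((c , d) :*ℂ (a , b))) refl a b c d

  *ℂ-identityˡ : ∀ x → 1ℂ *ℂ x ≈ℂ x
  *ℂ-identityˡ (a +i b) =
      solve 2 (λ a b → proj₁ (:1ℂ :*ℂ (a , b)) := a) refl a b
    , solve 2 (λ a b → proj₂ (:1ℂ :*ℂ (a , b)) := b) refl a b

  *ℂ-zeroʳ : ∀ x → x *ℂ 0ℂ ≈ℂ 0ℂ
  *ℂ-zeroʳ (a +i b) =
      solve 2 (λ a b → proj₁ ((a , b) :*ℂ :0ℂ) := con (+ 0)) refl a b
    , solve 2 (λ a b → proj₂ ((a , b) :*ℂ :0ℂ) := con (+ 0)) refl a b

  *ℂ-commutativeMonoid : CommutativeMonoid c ℓ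
  *ℂ-commutativeMonoid = record
    { Carrier             = ℂ
    ; _≈_                 = _≈ℂ_
    ; _∙_                 = _*ℂ_
    ; ε                   = 1ℂ
    ; isCommutativeMonoid = record
      { isMonoid = record
        { isSemigroup = record
          { isMagma = record { isEquivalence = ≈ℂ-isEquivalence ; ∙-cong = *ℂ-cong }
          ; assoc   = *ℂ-assoc
          }
        ; identity = *ℂ-identityˡ , λ x → ≈ℂ-trans (*ℂ-comm x 1ℂ) (*ℂ-identityˡ x)
        }
      ; comm = *ℂ-comm
      }
    }

  open CommutativeMonoid *ℂ-commutativeMonoid public
    using () renaming (setoid to ℂ-setoid; ∙-congˡ to *ℂ-congˡ)
  open CommutativeMonoid *ℂ-commutativeMonoid using (identityʳ; commutativeSemigroup)
  open import Algebra.Properties.CommutativeSemigroup commutativeSemigroup using (interchange)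
  open import Relation.Binary.Reasoning.Setoid ℂ-setoid

  ^ℂ-congˡ : ∀ {x y} k → x ≈ℂ y → x ^ℂ k ≈ℂ y ^ℂ k
  ^ℂ-congˡ zero    x≈y = ≈ℂ-refl
  ^ℂ-congˡ (suc k) x≈y = *ℂ-cong x≈y (^ℂ-congˡ k x≈y)

  ^ℂ-distrib-*ℂ : ∀ x y k → (x *ℂ y) ^ℂ k ≈ℂ x ^ℂ k *ℂ y ^ℂ k
  ^ℂ-distrib-*ℂ x y zero    = ≈ℂ-sym (*ℂ-identityˡ 1ℂ)
  ^ℂ-distrib-*ℂ x y (suc k) = begin
    (x *ℂ y) *ℂ (x *ℂ y) ^ℂ k       ≈⟨ *ℂ-congˡ (^ℂ-distrib-*ℂ x y k) ⟩
    (x *ℂ y) *ℂ (x ^ℂ k *ℂ y ^ℂ k)  ≈⟨ interchange x y (x ^ℂ k) (y ^ℂ k) ⟩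
    (x *ℂ x ^ℂ k) *ℂ (y *ℂ y ^ℂ k)  ∎

  conj-*ℂ : ∀ x y → conj (x *ℂ y) ≈ℂ conj x *ℂ conj y
  conj-*ℂ (a +i b) (c +i d) =
      solve 4 (λ a b c d → proj₁ (:conj ((a , b) :*ℂ (c , d)))
                          := proj₁ (:conj (a , b) :*ℂ :conj (c , d))) refl a b c d
    , solve 4 (λ a b c d → proj₂ (:conj ((a , b) :*ℂ (c , d)))
                          := proj₂ (:conj (a , b) :*ℂ :conj (c , d))) refl a b c d

  conj-^ℂ : ∀ x k → conj (x ^ℂ k) ≈ℂ conj x ^ℂ k
  conj-^ℂ x zero    = refl , -0#≈0#
  conj-^ℂ x (suc k) = begin
    conj (x *ℂ x ^ℂ k)       ≈⟨ conj-*ℂ x (x ^ℂ k) ⟩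
    conj x *ℂ conj (x ^ℂ k)  ≈⟨ *ℂ-congˡ (conj-^ℂ x k) ⟩
    conj x *ℂ conj x ^ℂ k    ∎

  recip-inverse : ∀ {u} → ¬ u ≈ℂ 0ℂ → recip u *ℂ u ≈ℂ 1ℂ
  recip-inverse {c +i d} u≉0 =
      trans (solve 3 (λ c d m → proj₁ ((c :* m , :- (d :* m)) :*ℂ (c , d)) := (c :* c :+ d :* d) :* m)
                     refl c d m)
            (⁻¹-inverse _ normSq≉0)
    , solve 3 (λ c d m → proj₂ ((c :* m , :- (d :* m)) :*ℂ (c , d)) := con (+ 0)) refl c d m
    where
    m : Carrier
    m = normSq (c +i d) ⁻¹
    normSq≉0 : ¬ normSq (c +i d) ≈ 0#
    normSq≉0 n≈0 = u≉0 (x*x+y*y≈0⇒x≈0 n≈0 , x*x+y*y≈0⇒x≈0 (trans (+-comm _ _) n≈0))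

  x≈[x*u]*recip-u : ∀ {u} x → ¬ u ≈ℂ 0ℂ → x ≈ℂ (x *ℂ u) *ℂ recip u
  x≈[x*u]*recip-u {u} x u≉0 = begin
    x                    ≈⟨ identityʳ x ⟨
    x *ℂ 1ℂ              ≈⟨ *ℂ-congˡ (recip-inverse u≉0) ⟨
    x *ℂ (recip u *ℂ u)  ≈⟨ *ℂ-congˡ (*ℂ-comm (recip u) u) ⟩
    x *ℂ (u *ℂ recip u)  ≈⟨ *ℂ-assoc x u (recip u) ⟨
    (x *ℂ u) *ℂ recip u  ∎

  *ℂ-cancelʳ : ∀ {u x y} → ¬ u ≈ℂ 0ℂ → x *ℂ u ≈ℂ y *ℂ u → x ≈ℂ y
  *ℂ-cancelʳ {u} {x} {y} u≉0 xu≈yu = begin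
    x                    ≈⟨ x≈[x*u]*recip-u x u≉0 ⟩
    (x *ℂ u) *ℂ recip u  ≈⟨ *ℂ-cong xu≈yu ≈ℂ-refl ⟩
    (y *ℂ u) *ℂ recip u  ≈⟨ x≈[x*u]*recip-u y u≉0 ⟨
    y                    ∎

  /ℂ-inverse : ∀ {u} v → ¬ u ≈ℂ 0ℂ → (v /ℂ u) *ℂ u ≈ℂ v
  /ℂ-inverse {u} v u≉0 = begin
    (v *ℂ recip u) *ℂ u  ≈⟨ *ℂ-assoc v (recip u) u ⟩
    v *ℂ (recip u *ℂ u)  ≈⟨ *ℂ-congˡ (recip-inverse u≉0) ⟩
    v *ℂ 1ℂ              ≈⟨ identityʳ v ⟩
    v                    ∎

  *ℂ⇒/ℂ : ∀ {u x v} → ¬ u ≈ℂ 0ℂ → x *ℂ u ≈ℂ v → v /ℂ u ≈ℂ x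
  *ℂ⇒/ℂ {v = v} u≉0 xu≈v = *ℂ-cancelʳ u≉0 (≈ℂ-trans (/ℂ-inverse v u≉0) (≈ℂ-sym xu≈v))

  [x*[p-1]]*u≈x*[p*u-u] : ∀ x p u → (x *ℂ (p -ℂ 1ℂ)) *ℂ u ≈ℂ x *ℂ (p *ℂ u -ℂ u)
  [x*[p-1]]*u≈x*[p*u-u] (a +i b) (c +i d) (e +i f) =
      solve 6 (λ a b c d e f → proj₁ ((a , b) :*ℂ ((c , d) :-ℂ :1ℂ) :*ℂ (e , f))
                              := proj₁ ((a , b) :*ℂ ((c , d) :*ℂ (e , f) :-ℂ (e , f)))) refl a b c d e f
    , solve 6 (λ a b c d e f → proj₂ ((a , b) :*ℂ ((c , d) :-ℂ :1ℂ) :*ℂ (e , f))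
                              := proj₂ ((a , b) :*ℂ ((c , d) :*ℂ (e , f) :-ℂ (e , f)))) refl a b c d e f

  is-1≈i[s+i] : ∀ s → (0# +i s) -ℂ 1ℂ ≈ℂ iℂ *ℂ (s +i 1#)
  is-1≈i[s+i] s =
      solve 1 (λ s → proj₁ ((con (+ 0) , s) :-ℂ :1ℂ) := proj₁ (:iℂ :*ℂ (s , con (+ 1)))) refl s
    , solve 1 (λ s → proj₂ ((con (+ 0) , s) :-ℂ :1ℂ) := proj₂ (:iℂ :*ℂ (s , con (+ 1)))) refl s

  is+1≈i[s-i] : ∀ s → (0# +i s) +ℂ 1ℂ ≈ℂ iℂ *ℂ conj (s +i 1#)
  is+1≈i[s-i] s =
      solve 1 (λ s → proj₁ ((con (+ 0) , s) :+ℂ :1ℂ) := proj₁ (:iℂ :*ℂ :conj (s , con (+ 1)))) refl s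
    , solve 1 (λ s → proj₂ ((con (+ 0) , s) :+ℂ :1ℂ) := proj₂ (:iℂ :*ℂ :conj (s , con (+ 1)))) refl s

  [-1+it]*[z̄-z]≈2*[tb+ib] : ∀ t a b →
    ((- 1#) +i t) *ℂ (conj (a +i b) -ℂ (a +i b)) ≈ℂ 2ℂ *ℂ ((t * b) +i b)
  [-1+it]*[z̄-z]≈2*[tb+ib] t a b =
      solve 3 (λ t a b → proj₁ ((:- con (+ 1) , t) :*ℂ (:conj (a , b) :-ℂ (a , b)))
                        := proj₁ ((con (+ 2) , con (+ 0)) :*ℂ (t :* b , b))) refl t a b
    , solve 3 (λ t a b → proj₂ ((:- con (+ 1) , t) :*ℂ (:conj (a , b) :-ℂ (a , b)))
                        := proj₂ ((con (+ 2) , con (+ 0)) :*ℂ (t :* b , b))) refl t a b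

  [is]^2≈-s² : ∀ s → (0# +i s) ^ℂ 2 ≈ℂ (- (s * s)) +i 0#
  [is]^2≈-s² s =
      solve 1 (λ s → proj₁ ((con (+ 0) , s) :*ℂ ((con (+ 0) , s) :*ℂ :1ℂ)) := :- (s :* s)) refl s
    , solve 1 (λ s → proj₂ ((con (+ 0) , s) :*ℂ ((con (+ 0) , s) :*ℂ :1ℂ)) := con (+ 0)) refl s

  re-[s+i]^2 : ∀ s → re ((s +i 1#) ^ℂ 2) ≈ s * s - 1#
  re-[s+i]^2 s = solve 1 (λ s → let z = s , con (+ 1) in
                                proj₁ (z :*ℂ (z :*ℂ :1ℂ)) := s :* s :- con (+ 1)) refl s

  im-[s+i]^2 : ∀ s → im ((s +i 1#) ^ℂ 2) ≈ fromℕ′ 2 * s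
  im-[s+i]^2 s = solve 1 (λ s → let z = s , con (+ 1) in
                                proj₂ (z :*ℂ (z :*ℂ :1ℂ)) := con (+ 2) :* s) refl s

  re-[s+i]^3 : ∀ s → re ((s +i 1#) ^ℂ 3) ≈ s * (s * s - fromℕ′ 3)
  re-[s+i]^3 s = solve 1 (λ s → let z = s , con (+ 1) in
                                proj₁ (z :*ℂ (z :*ℂ (z :*ℂ :1ℂ))) := s :* (s :* s :- con (+ 3))) refl s

  im-[s+i]^3 : ∀ s → im ((s +i 1#) ^ℂ 3) ≈ fromℕ′ 3 * (s * s) - 1#
  im-[s+i]^3 s = solve 1 (λ s → let z = s , con (+ 1) in
                                proj₂ (z :*ℂ (z :*ℂ (z :*ℂ :1ℂ))) := con (+ 3) :* (s :* s) :- con (+ 1)) refl s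

module Stretching {c ℓ} (R : RealAlgebraicNumbers c ℓ) where
  open RealAlgebraicNumbers R
  open OrderedField R using (<⇒≉; 0<fromℕ′-suc)
  open Complex R
  open ComplexArithmetic R
  open import Algebra.Properties.Group +-group using (x∙y⁻¹≈ε⇒x≈y)
  open import Relation.Binary.Reasoning.Setoid ℂ-setoid

  ObtainableImag : ℂ → Carrier → Set (c ⊔ ℓ)
  ObtainableImag y s = ∃ λ w → Obtainable y w × w ≈ℂ (0# +i s)

  imag≉1 : ∀ {w s} → w ≈ℂ 0# +i s → ¬ w ≈ℂ 1ℂ
  imag≉1 (re≈0 , _) (re≈1 , _) = <⇒≉ 0<1 (trans (sym re≈0) re≈1)

  -- is - 1 = iz and is + 1 = iz̄ for z = s + i.
  [w+1]/[w-1]*z≈z̄ : ∀ {w s} → w ≈ℂ 0# +i s →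
                    ((w +ℂ 1ℂ) /ℂ (w -ℂ 1ℂ)) *ℂ (s +i 1#) ≈ℂ conj (s +i 1#)
  [w+1]/[w-1]*z≈z̄ {w} {s} w≈is = *ℂ-cancelʳ i≉0 (begin
    (q *ℂ z) *ℂ iℂ     ≈⟨ *ℂ-assoc q z iℂ ⟩
    q *ℂ (z *ℂ iℂ)     ≈⟨ *ℂ-congˡ (*ℂ-comm z iℂ) ⟩
    q *ℂ (iℂ *ℂ z)     ≈⟨ *ℂ-congˡ (≈ℂ-trans (-ℂ-cong w≈is ≈ℂ-refl) (is-1≈i[s+i] s)) ⟨
    q *ℂ (w -ℂ 1ℂ)     ≈⟨ /ℂ-inverse (w +ℂ 1ℂ) w-1≉0 ⟩
    w +ℂ 1ℂ            ≈⟨ ≈ℂ-trans (+ℂ-cong w≈is ≈ℂ-refl) (is+1≈i[s-i] s) ⟩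
    iℂ *ℂ conj z       ≈⟨ *ℂ-comm iℂ (conj z) ⟩
    conj z *ℂ iℂ       ∎)
    where
    z q : ℂ
    z = s +i 1#
    q = (w +ℂ 1ℂ) /ℂ (w -ℂ 1ℂ)
    i≉0 : ¬ iℂ ≈ℂ 0ℂ
    i≉0 (_ , 1≈0) = <⇒≉ 0<1 (sym 1≈0)
    w-1≉0 : ¬ w -ℂ 1ℂ ≈ℂ 0ℂ
    w-1≉0 (re-1≈0 , im≈0) = imag≉1 w≈is (x∙y⁻¹≈ε⇒x≈y _ _ re-1≈0 , x∙y⁻¹≈ε⇒x≈y _ _ im≈0)

  stretchBase-imag : ∀ k {w s} → w ≈ℂ 0# +i s →
                     stretchBase k w *ℂ (s +i 1#) ^ℂ k ≈ℂ conj ((s +i 1#) ^ℂ k)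
  stretchBase-imag k {w} {s} w≈is = begin
    q ^ℂ k *ℂ z ^ℂ k    ≈⟨ ^ℂ-distrib-*ℂ q z k ⟨
    (q *ℂ z) ^ℂ k       ≈⟨ ^ℂ-congˡ k ([w+1]/[w-1]*z≈z̄ w≈is) ⟩
    conj z ^ℂ k         ≈⟨ conj-^ℂ z k ⟨
    conj (z ^ℂ k)       ∎
    where
    z q : ℂ
    z = s +i 1#
    q = (w +ℂ 1ℂ) /ℂ (w -ℂ 1ℂ)

  -- With Z = (s + i)^k the stretch base is Z̄/Z, so the k-stretch of is is i Re Z / Im Z;
  -- for s = cot φ this is i cot (kφ).
  stretch-imag : ∀ k {y s t} → ObtainableImag y s → ¬ im ((s +i 1#) ^ℂ suc k) ≈ 0# →
                 t * im ((s +i 1#) ^ℂ suc k) ≈ re ((s +i 1#) ^ℂ suc k) → ObtainableImag y t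
  stretch-imag k {y} {s} {t} (w , obtainable , w≈is) Im≉0 t·Im≈Re =
    stretch (suc k) w , stretch′ k obtainable (imag≉1 w≈is) u≉0 , stretch≈it
    where
    Z X base u : ℂ
    Z    = (s +i 1#) ^ℂ suc k
    X    = (- 1#) +i t
    base = stretchBase (suc k) w
    u    = base -ℂ 1ℂ

    Z≉0 : ¬ Z ≈ℂ 0ℂ
    Z≉0 (_ , Im≈0) = Im≉0 Im≈0

    X·u≈2 : X *ℂ u ≈ℂ 2ℂ
    X·u≈2 = *ℂ-cancelʳ Z≉0 (begin
      (X *ℂ u) *ℂ Z               ≈⟨ [x*[p-1]]*u≈x*[p*u-u] X base Z ⟩
      X *ℂ (base *ℂ Z -ℂ Z)       ≈⟨ *ℂ-congˡ (-ℂ-cong (stretchBase-imag (suc k) w≈is) ≈ℂ-refl) ⟩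
      X *ℂ (conj Z -ℂ Z)          ≈⟨ [-1+it]*[z̄-z]≈2*[tb+ib] t (re Z) (im Z) ⟩
      2ℂ *ℂ ((t * im Z) +i im Z)  ≈⟨ *ℂ-congˡ (t·Im≈Re , refl) ⟩
      2ℂ *ℂ Z                     ∎)

    u≉0 : ¬ u ≈ℂ 0ℂ
    u≉0 u≈0 = <⇒≉ (0<fromℕ′-suc 1) (sym (proj₁ (begin
      2ℂ       ≈⟨ X·u≈2 ⟨
      X *ℂ u   ≈⟨ *ℂ-congˡ u≈0 ⟩
      X *ℂ 0ℂ  ≈⟨ *ℂ-zeroʳ X ⟩
      0ℂ       ∎)))

    stretch≈it : stretch (suc k) w ≈ℂ 0# +i t
    stretch≈it = begin
      1ℂ +ℂ 2ℂ /ℂ u  ≈⟨ +ℂ-cong ≈ℂ-refl (*ℂ⇒/ℂ u≉0 X·u≈2) ⟩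
      1ℂ +ℂ X        ≈⟨ -‿inverseʳ 1# , +-identityˡ t ⟩
      0# +i t        ∎

module CotangentBounds {c ℓ} (R : RealAlgebraicNumbers c ℓ) where
  open RealAlgebraicNumbers R
  open OrderedField R
  open IntegerCoefficients commRing using (fromℕ′; solve; _:=_; con; _:+_; _:*_; _:-_)
  open import Algebra.Properties.Group +-group using (x≈y⇒x∙y⁻¹≈ε)

  doubling-relation : ∀ {s} t → t * (fromℕ′ 2 * s) ≈ s * s - 1# →
                      t * t * (fromℕ′ 4 * (s * s)) ≈ (s * s - 1#) * (s * s - 1#)
  doubling-relation {s} t t·2s≈u-1 = trans (squares t s) (*-cong t·2s≈u-1 t·2s≈u-1)
    where
    squares : ∀ t s → t * t * (fromℕ′ 4 * (s * s)) ≈ (t * (fromℕ′ 2 * s)) * (t * (fromℕ′ 2 * s))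
    squares = solve 2 (λ t s → t :* t :* (con (+ 4) :* (s :* s))
                             := (t :* (con (+ 2) :* s)) :* (t :* (con (+ 2) :* s))) refl

  doubling-contracts : ∀ {u t} → 1# < u → t * t * (fromℕ′ 4 * u) ≈ (u - 1#) * (u - 1#) →
                       t * t < u - 1#
  doubling-contracts {u} {t} 1<u t²·4u≈[u-1]² = *-cancelʳ-<-pos 0<4u (begin-strict
    t * t * (fromℕ′ 4 * u)     ≈⟨ t²·4u≈[u-1]² ⟩
    (u - 1#) * (u - 1#)        <⟨ 0<y-x⇒x<y (<-resp-≈ refl (gap u) (*-pos 0<u-1 0<3u+1)) ⟩
    (u - 1#) * (fromℕ′ 4 * u)  ∎)
    where
    0<u : 0# < u
    0<u = <-trans 0<1 1<u
    0<u-1 : 0# < u - 1#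
    0<u-1 = x<y⇒0<y-x 1<u
    0<4u : 0# < fromℕ′ 4 * u
    0<4u = *-pos (0<fromℕ′-suc 3) 0<u
    0<3u+1 : 0# < fromℕ′ 3 * u + 1#
    0<3u+1 = +-pos (*-pos (0<fromℕ′-suc 2) 0<u) (<⇒≤ 0<1)
    gap : ∀ u → (u - 1#) * (fromℕ′ 3 * u + 1#) ≈ (u - 1#) * (fromℕ′ 4 * u) - (u - 1#) * (u - 1#)
    gap = solve 1 (λ u → (u :- con (+ 1)) :* (con (+ 3) :* u :+ con (+ 1))
                       := (u :- con (+ 1)) :* (con (+ 4) :* u) :- (u :- con (+ 1)) :* (u :- con (+ 1))) refl

  doubling-hits-1 : ∀ {u t} → t * t ≈ 1# → t * t * (fromℕ′ 4 * u) ≈ (u - 1#) * (u - 1#) →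
                    (u - 1#) * (u - 1#) - fromℕ′ 4 * u ≈ 0#
  doubling-hits-1 {u} {t} t²≈1 t²·4u≈[u-1]² = x≈y⇒x∙y⁻¹≈ε (begin-equality
    (u - 1#) * (u - 1#)     ≈⟨ t²·4u≈[u-1]² ⟨
    t * t * (fromℕ′ 4 * u)  ≈⟨ *-congʳ t²≈1 ⟩
    1# * (fromℕ′ 4 * u)     ≈⟨ *-identityˡ _ ⟩
    fromℕ′ 4 * u            ∎)

  -- The exceptional case s² = 3 + 2√2, in which the 2-stretch lands on ±i.
  module _ {s} (1<u : 1# < s * s) (rel≈0 : (s * s - 1#) * (s * s - 1#) - fromℕ′ 4 * (s * s) ≈ 0#) where
    private
      u T : Carrier
      u = s * s
      T = fromℕ′ 3 * u - 1#
      0<u : 0# < u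
      0<u = <-trans 0<1 1<u

    0<3u-1 : 0# < fromℕ′ 3 * (s * s) - 1#
    0<3u-1 = <-resp-≈ refl (sym (shift u))
               (+-pos (0<fromℕ′-suc 1) (<⇒≤ (*-pos (0<fromℕ′-suc 2) (x<y⇒0<y-x 1<u))))
      where
      shift : ∀ u → fromℕ′ 3 * u - 1# ≈ fromℕ′ 2 + fromℕ′ 3 * (u - 1#)
      shift = solve 1 (λ u → con (+ 3) :* u :- con (+ 1) := con (+ 2) :+ con (+ 3) :* (u :- con (+ 1))) refl

    private
      u-3≉0 : ¬ u - fromℕ′ 3 ≈ 0#
      u-3≉0 u-3≈0 = <⇒≉ (0<fromℕ′-suc 7) (sym (begin-equality
        fromℕ′ 8                         ≈⟨ x≈y+r∧r≈0⇒x≈y (square u) rel≈0 ⟨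
        (u - fromℕ′ 3) * (u - fromℕ′ 3)  ≈⟨ *-congʳ u-3≈0 ⟩
        0# * (u - fromℕ′ 3)              ≈⟨ zeroˡ _ ⟩
        0#                               ∎))
        where
        square : ∀ u → (u - fromℕ′ 3) * (u - fromℕ′ 3)
                     ≈ fromℕ′ 8 + ((u - 1#) * (u - 1#) - fromℕ′ 4 * u)
        square = solve 1 (λ u → (u :- con (+ 3)) :* (u :- con (+ 3))
                              := con (+ 8) :+ ((u :- con (+ 1)) :* (u :- con (+ 1)) :- con (+ 4) :* u)) refl

    tripling-lands : ∀ {t} → t * (fromℕ′ 3 * (s * s) - 1#) ≈ s * (s * s - fromℕ′ 3) →
                     ¬ t ≈ 0# × t * t < 1#
    tripling-lands {t} tT≈s[u-3] = t≉0 , *-cancelʳ-<-pos (*-pos 0<3u-1 0<3u-1) (begin-strict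
      t * t * (T * T)                              ≈⟨ squares t T ⟩
      (t * T) * (t * T)                            ≈⟨ *-cong tT≈s[u-3] tT≈s[u-3] ⟩
      (s * (u - fromℕ′ 3)) * (s * (u - fromℕ′ 3))  ≈⟨ squares s (u - fromℕ′ 3) ⟨
      u * ((u - fromℕ′ 3) * (u - fromℕ′ 3))        <⟨ 0<y-x⇒x<y (<-resp-≈ refl (sym T²-gap) 0<8u[u-1]) ⟩
      T * T                                        ≈⟨ *-identityˡ (T * T) ⟨
      1# * (T * T)                                 ∎)
      where
      t≉0 : ¬ t ≈ 0#
      t≉0 t≈0 = *-≉0 (1<x*x⇒x≉0 1<u) u-3≉0 (trans (sym tT≈s[u-3]) (trans (*-congʳ t≈0) (zeroˡ T)))
      squares : ∀ x y → x * x * (y * y) ≈ (x * y) * (x * y)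
      squares = solve 2 (λ x y → x :* x :* (y :* y) := (x :* y) :* (x :* y)) refl
      0<8u[u-1] : 0# < fromℕ′ 8 * u * (u - 1#)
      0<8u[u-1] = *-pos (*-pos (0<fromℕ′-suc 7) 0<u) (x<y⇒0<y-x 1<u)
      gap : ∀ u → (fromℕ′ 3 * u - 1#) * (fromℕ′ 3 * u - 1#) - u * ((u - fromℕ′ 3) * (u - fromℕ′ 3))
                ≈ fromℕ′ 8 * u * (u - 1#) + (1# - u) * ((u - 1#) * (u - 1#) - fromℕ′ 4 * u)
      gap = solve 1 (λ u → (con (+ 3) :* u :- con (+ 1)) :* (con (+ 3) :* u :- con (+ 1))
                            :- u :* ((u :- con (+ 3)) :* (u :- con (+ 3)))
                         := con (+ 8) :* u :* (u :- con (+ 1))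
                            :+ (con (+ 1) :- u) :* ((u :- con (+ 1)) :* (u :- con (+ 1)) :- con (+ 4) :* u)) refl
      T²-gap : T * T - u * ((u - fromℕ′ 3) * (u - fromℕ′ 3)) ≈ fromℕ′ 8 * u * (u - 1#)
      T²-gap = x≈y+r∧r≈0⇒x≈y (gap u) (trans (*-congˡ rel≈0) (zeroʳ _))

module Descent {c ℓ} (R : RealAlgebraicNumbers c ℓ) where
  open RealAlgebraicNumbers R
  open OrderedField R
  open IntegerCoefficients commRing using (fromℕ′)
  open Complex R
  open ComplexArithmetic R
    using (≈ℂ-trans; ^ℂ-congˡ; [is]^2≈-s²; re-[s+i]^2; im-[s+i]^2; re-[s+i]^3; im-[s+i]^3)
  open Stretching R using (ObtainableImag; stretch-imag)
  open CotangentBounds R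
  open import Algebra.Properties.Ring ring using (-0#≈0#)

  ObtainableInInterval : ℂ → Set (c ⊔ ℓ)
  ObtainableInInterval y = ∃ λ (w : ℂ) → ∃ λ (y′ : Carrier) →
    Obtainable y w × w ≈ℂ (y′ +i 0#) × (- 1# < y′) × (y′ < 0#)

  squaring : ∀ {y s} → ObtainableImag y s → ¬ s ≈ 0# → s * s < 1# → ObtainableInInterval y
  squaring {s = s} (w , obtainable , w≈is) s≉0 s²<1 =
    w ^ℂ 2 , - (s * s) , thick 1 obtainable , ≈ℂ-trans (^ℂ-congˡ 2 w≈is) ([is]^2≈-s² s) ,
    neg-antimono-< s²<1 , <-resp-≈ refl -0#≈0# (neg-antimono-< (x≉0⇒0<x*x s≉0))

  doubling : ∀ {y s} → ObtainableImag y s → ¬ s ≈ 0# →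
             ∃ λ t → ObtainableImag y t × t * (fromℕ′ 2 * s) ≈ s * s - 1#
  doubling {s = s} obtainable s≉0 = t , stretch-imag 1 obtainable Im≉0 t·Im≈Re , y*x⁻¹*x≈y _ 2s≉0
    where
    t : Carrier
    t = (s * s - 1#) * (fromℕ′ 2 * s) ⁻¹
    2s≉0 : ¬ fromℕ′ 2 * s ≈ 0#
    2s≉0 = *-≉0 (λ 2≈0 → <⇒≉ (0<fromℕ′-suc 1) (sym 2≈0)) s≉0
    Im≉0 : ¬ im ((s +i 1#) ^ℂ 2) ≈ 0#
    Im≉0 Im≈0 = 2s≉0 (trans (sym (im-[s+i]^2 s)) Im≈0)
    t·Im≈Re : t * im ((s +i 1#) ^ℂ 2) ≈ re ((s +i 1#) ^ℂ 2)
    t·Im≈Re = trans (*-congˡ (im-[s+i]^2 s)) (trans (y*x⁻¹*x≈y _ 2s≉0) (sym (re-[s+i]^2 s)))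

  tripling : ∀ {y s} → ObtainableImag y s → ¬ fromℕ′ 3 * (s * s) - 1# ≈ 0# →
             ∃ λ t → ObtainableImag y t × t * (fromℕ′ 3 * (s * s) - 1#) ≈ s * (s * s - fromℕ′ 3)
  tripling {s = s} obtainable T≉0 = t , stretch-imag 2 obtainable Im≉0 t·Im≈Re , y*x⁻¹*x≈y _ T≉0
    where
    t : Carrier
    t = s * (s * s - fromℕ′ 3) * (fromℕ′ 3 * (s * s) - 1#) ⁻¹
    Im≉0 : ¬ im ((s +i 1#) ^ℂ 3) ≈ 0#
    Im≉0 Im≈0 = T≉0 (trans (sym (im-[s+i]^3 s)) Im≈0)
    t·Im≈Re : t * im ((s +i 1#) ^ℂ 3) ≈ re ((s +i 1#) ^ℂ 3)
    t·Im≈Re = trans (*-congˡ (im-[s+i]^3 s)) (trans (y*x⁻¹*x≈y _ T≉0) (sym (re-[s+i]^3 s)))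

  exceptional : ∀ {y s} → ObtainableImag y s → 1# < s * s →
                (s * s - 1#) * (s * s - 1#) - fromℕ′ 4 * (s * s) ≈ 0# → ObtainableInInterval y
  exceptional {y} {s} obtainable 1<u rel≈0 = land (tripling obtainable T≉0)
    where
    T≉0 : ¬ fromℕ′ 3 * (s * s) - 1# ≈ 0#
    T≉0 T≈0 = <⇒≉ (0<3u-1 1<u rel≈0) (sym T≈0)
    land : (∃ λ t → ObtainableImag y t × t * (fromℕ′ 3 * (s * s) - 1#) ≈ s * (s * s - fromℕ′ 3)) →
           ObtainableInInterval y
    land (t , obtainable-t , tT≈s[u-3]) =
      squaring obtainable-t (proj₁ landing) (proj₂ landing)
      where
      landing : ¬ t ≈ 0# × t * t < 1#
      landing = tripling-lands 1<u rel≈0 tT≈s[u-3]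

  ObtainableImagBelow : ℂ → Carrier → Set (c ⊔ ℓ)
  ObtainableImagBelow y s = ∃ λ t → ObtainableImag y t × 1# < t * t × t * t < s * s - 1#

  doubling-step : ∀ {y s} → ObtainableImag y s → 1# < s * s →
                  ObtainableInInterval y ⊎ ObtainableImagBelow y s
  doubling-step {y} {s} obtainable 1<u = compare (doubling obtainable (1<x*x⇒x≉0 1<u))
    where
    compare : (∃ λ t → ObtainableImag y t × t * (fromℕ′ 2 * s) ≈ s * s - 1#) →
              ObtainableInInterval y ⊎ ObtainableImagBelow y s
    compare (t , obtainable-t , t·2s≈u-1) = by-size (<-trichotomy (t * t) 1#)
      where
      t²·4u≈[u-1]² : t * t * (fromℕ′ 4 * (s * s)) ≈ (s * s - 1#) * (s * s - 1#)
      t²·4u≈[u-1]² = doubling-relation t t·2s≈u-1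
      t≉0 : ¬ t ≈ 0#
      t≉0 t≈0 = <⇒≉ (x<y⇒0<y-x 1<u) (sym (trans (sym t·2s≈u-1) (trans (*-congʳ t≈0) (zeroˡ _))))
      by-size : t * t < 1# ⊎ t * t ≈ 1# ⊎ 1# < t * t → ObtainableInInterval y ⊎ ObtainableImagBelow y s
      by-size (inj₁ t²<1)        = inj₁ (squaring obtainable-t t≉0 t²<1)
      by-size (inj₂ (inj₁ t²≈1)) =
        inj₁ (exceptional obtainable 1<u (doubling-hits-1 t²≈1 t²·4u≈[u-1]²))
      by-size (inj₂ (inj₂ 1<t²)) =
        inj₂ (t , obtainable-t , 1<t² , doubling-contracts 1<u t²·4u≈[u-1]²)

  descent : ∀ N {y s} → ObtainableImag y s → 1# < s * s → s * s < fromℕ N → ObtainableInInterval y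
  descent zero    _                  1<u u<0   = ⊥-elim (<-asym 0<1 (<-trans 1<u u<0))
  descent (suc N) {y} {s} obtainable 1<u u<1+N = continue (doubling-step obtainable 1<u)
    where
    continue : ObtainableInInterval y ⊎ ObtainableImagBelow y s → ObtainableInInterval y
    continue (inj₁ landed)                             = landed
    continue (inj₂ (t , obtainable-t , 1<t² , t²<u-1)) =
      descent N obtainable-t 1<t² (<-trans t²<u-1 (x<1+y⇒x-1<y u<1+N))

lemma21 : ∀ {c ℓ} (R : RealAlgebraicNumbers c ℓ) →
    let open RealAlgebraicNumbers R
        open Complex R
    in (r : Carrier) → ¬ (r ≈ 0#) → ¬ (r ≈ 1#) → ¬ (r ≈ - 1#) →
       ∃ λ (w : ℂ) → ∃ λ (y′ : Carrier) →
         Obtainable (0# +i r) w × w ≈ℂ (y′ +i 0#) × (- 1# < y′) × (y′ < 0#)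
lemma21 R r r≉0 r≉1 r≉-1 = by-size (<-trichotomy (r * r) 1#)
  where
  open RealAlgebraicNumbers R
  open Complex R
  open OrderedField R using (x*x≈1⇒x≈1⊎x≈-1)
  open Archimedean R using (archimedean)
  open Stretching R using (ObtainableImag)
  open Descent R using (ObtainableInInterval; squaring; descent)

  start : ObtainableImag (0# +i r) r
  start = 0# +i r , done , refl , refl

  by-size : r * r < 1# ⊎ r * r ≈ 1# ⊎ 1# < r * r → ObtainableInInterval (0# +i r)
  by-size (inj₁ r²<1)        = squaring start r≉0 r²<1
  by-size (inj₂ (inj₁ r²≈1)) = ⊥-elim ([ r≉1 , r≉-1 ] (x*x≈1⇒x≈1⊎x≈-1 r²≈1))
  by-size (inj₂ (inj₂ 1<r²)) = descent (proj₁ bound) start 1<r² (proj₂ bound)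
    where
    bound : ∃ λ N → r * r < fromℕ N
    bound = archimedean (r * r)
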